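{- Let $G_0,G_1\in\mathbb{Z}$ with $\gcd(G_0,G_1)=1$, and let $(G_n)_{n\ge0}$ satisfy $G_n=G_{n-1}+G_{n-2}$ for $n\ge2$. If $k$ is a positive integer with $k\equiv 2,6,10\pmod{12}$, then $$\gcd(G_{k+1}-G_1,\,G_{k+2}-G_2)=L_{k/2}.$$ In particular, $\mathcal{F}(k)=\mathcal{L}(k)=\mathcal{G}_{G_0,G_1}(k)=L_{k/2}$.
   Context: $L_n$ denotes the Lucas numbers ($L_0=2$, $L_1=1$, $L_n=L_{n-1}+L_{n-2}$). For a positive integer $k$, $\mathcal{G}_{G_0,G_1}(k)$ is the greatest common divisor of all integers $\sum_{i=0}^{k-1}G_{n+i}$, $n\ge1$; $\mathcal{F}(k)$ and $\mathcal{L}(k)$ denote this quantity for the Fibonacci sequence ($G_0=0,G_1=1$) and the Lucas sequence ($G_0=2,G_1=1$), respectively. -}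

module Defs where

open import Data.Nat using (ℕ; zero; suc)
open import Data.Integer using (ℤ; +_; _+_; _-_)
open import Data.Integer.Divisibility using (_∣_)
open import Data.Product using (_×_)

fib : ℕ → ℤ
fib zero = + 0
fib (suc zero) = + 1
fib (suc (suc n)) = fib (suc n) + fib n

lucas : ℕ → ℤ
lucas zero = + 2
lucas (suc zero) = + 1
lucas (suc (suc n)) = lucas (suc n) + lucas n

windowSum : (ℕ → ℤ) → ℕ → ℕ → ℤ
windowSum G n zero = + 0
windowSum G n (suc k) = G n + windowSum G (suc n) k

-- IsSumGCD G k d : d is the greatest common divisor of the set
-- { windowSum G n k : n ≥ 1 }, i.e. d divides every element, and every
-- common divisor of all elements divides d.  (With d ≥ 0 this pins down
-- 𝒢_{G0,G1}(k) = d.)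
IsSumGCD : (ℕ → ℤ) → ℕ → ℤ → Set
IsSumGCD G k d =
  (∀ n → d ∣ windowSum G (suc n) k) ×
  (∀ c → (∀ n → c ∣ windowSum G (suc n) k) → c ∣ d)

{-# OPTIONS --safe #-}
-- The condition k ≡ 2, 6, 10 (mod 12) says exactly that k = 2m with m odd.
-- Every sequence with G(n+2) = G(n+1) + G(n) satisfies
-- G(j+2m) + (−1)^m G(j) = L_m G(j+m), so for odd m, G(j+k) − G(j) = L_m G(j+m).
-- A window of k consecutive terms telescopes to G(n+k+1) − G(n+1); hence both
-- gcds in question are gcds of L_m times two consecutive terms of G, and
-- consecutive terms are coprime because gcd(G0, G1) = 1 propagates along the
-- recurrence.
module Submission where

open import Defs
open import Data.Nat using (ℕ; zero; suc; _+_; _%_; _/_; _<_)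
open import Data.Integer using (ℤ; +_; _-_; 0ℤ; 1ℤ; -1ℤ; ∣_∣; _*_; _^_; +≤+)
open import Data.Integer.GCD using (gcd; gcd[i,j]∣i; gcd[i,j]∣j; gcd-greatest)
open import Data.Product using (_×_; _,_; ∃-syntax)
open import Data.Sum using (_⊎_; inj₁; inj₂)
open import Relation.Binary.PropositionalEquality using (_≡_; refl; sym; trans; cong; cong₂; subst; module ≡-Reasoning)

import Data.Nat as ℕ
open import Data.Nat.Properties using (+-suc)
open import Data.Nat.DivMod using (m≡m%n+[m/n]*n; m∣n⇒o%n%m≡o%m; m*n/n≡m)
import Data.Nat.Divisibility as ℕ
import Data.Nat.GCD as ℕ
import Data.Nat.Tactic.RingSolver as ℕ-Solver
import Data.Integer as ℤ
open import Data.Integer.Properties using (abs-*; pos-*; 0≤i⇒+∣i∣≡i; *-identityʳ; *-distribʳ-+; +-identityˡ; +-mono-≤)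
open import Data.Integer.Divisibility using (_∣_)
import Data.Integer.Divisibility.Signed as Signed
open import Data.Integer.Tactic.RingSolver using (solve-∀)
open import Function using (_∘_)

Odd : ℕ → Set
Odd m = ∃[ t ] m ≡ suc (t + t)

-1^odd : ∀ {m} → Odd m → -1ℤ ^ m ≡ -1ℤ
-1^odd (zero , refl) = refl
-1^odd (suc t , refl) rewrite +-suc t t | -1^odd (t , refl) = refl

k%4≡2⇒twice-odd : ∀ k → k % 4 ≡ 2 → ∃[ m ] Odd m × k ≡ m + m
k%4≡2⇒twice-odd k k%4≡2 =
  suc (q + q) , (q , refl) , trans (m≡m%n+[m/n]*n k 4) (trans (cong (_+ q ℕ.* 4) k%4≡2) (regroup q))
  where
  q = k / 4
  regroup : ∀ q → 2 + q ℕ.* 4 ≡ suc (q + q) + suc (q + q)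
  regroup = ℕ-Solver.solve-∀

k%12≡2,6,10⇒k%4≡2 : ∀ k → (k % 12 ≡ 2 ⊎ k % 12 ≡ 6 ⊎ k % 12 ≡ 10) → k % 4 ≡ 2
k%12≡2,6,10⇒k%4≡2 k r = trans (sym (m∣n⇒o%n%m≡o%m 4 12 k (ℕ.divides 3 refl))) (residue r)
  where
  residue : (k % 12 ≡ 2 ⊎ k % 12 ≡ 6 ⊎ k % 12 ≡ 10) → k % 12 % 4 ≡ 2
  residue (inj₁ r) = cong (_% 4) r
  residue (inj₂ (inj₁ r)) = cong (_% 4) r
  residue (inj₂ (inj₂ r)) = cong (_% 4) r

[m+m]/2≡m : ∀ m → (m + m) / 2 ≡ m
[m+m]/2≡m m = trans (cong (_/ 2) (m+m≡m*2 m)) (m*n/n≡m m 2)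
  where
  m+m≡m*2 : ∀ m → m + m ≡ m ℕ.* 2
  m+m≡m*2 = ℕ-Solver.solve-∀

∣m+n∣m⇒∣n : ∀ {i m n} → i ∣ m ℤ.+ n → i ∣ m → i ∣ n
∣m+n∣m⇒∣n {i} {m} {n} i∣m+n i∣m =
  Signed.∣⇒∣ᵤ {i} {n} (Signed.∣m+n∣m⇒∣n (Signed.∣ᵤ⇒∣ {i} {m ℤ.+ n} i∣m+n) (Signed.∣ᵤ⇒∣ {i} {m} i∣m))

m∣m*n : ∀ m n → m ∣ m * n
m∣m*n m n = Signed.∣⇒∣ᵤ {m} {m * n} (Signed.∣m⇒∣m*n n Signed.∣-refl)

∣1⇒gcd≡1 : ∀ i j → gcd i j ∣ 1ℤ → gcd i j ≡ 1ℤ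
∣1⇒gcd≡1 i j g∣1 = cong +_ (ℕ.∣1⇒≡1 g∣1)

gcd-*ˡ : ∀ l a b → gcd (l * a) (l * b) ≡ + ∣ l ∣ * gcd a b
gcd-*ˡ l a b = begin
    + ℕ.gcd ∣ l * a ∣ ∣ l * b ∣
  ≡⟨ cong₂ (λ x y → + ℕ.gcd x y) (abs-* l a) (abs-* l b) ⟩
    + ℕ.gcd (∣ l ∣ ℕ.* ∣ a ∣) (∣ l ∣ ℕ.* ∣ b ∣)
  ≡⟨ cong +_ (sym (ℕ.c*gcd[m,n]≡gcd[cm,cn] (∣ l ∣) (∣ a ∣) (∣ b ∣))) ⟩
    + (∣ l ∣ ℕ.* ℕ.gcd ∣ a ∣ ∣ b ∣)
  ≡⟨ pos-* (∣ l ∣) (ℕ.gcd ∣ a ∣ ∣ b ∣) ⟩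
    + ∣ l ∣ * gcd a b ∎
  where open ≡-Reasoning

gcd-*ˡ-coprime : ∀ {l a b} → 0ℤ ℤ.≤ l → gcd a b ≡ 1ℤ → gcd (l * a) (l * b) ≡ l
gcd-*ˡ-coprime {l} {a} {b} 0≤l coprime =
  trans (gcd-*ˡ l a b) (trans (cong₂ _*_ (0≤i⇒+∣i∣≡i 0≤l) coprime) (*-identityʳ l))

lucas-nonneg : ∀ n → 0ℤ ℤ.≤ lucas n
lucas-nonneg zero = +≤+ ℕ.z≤n
lucas-nonneg (suc zero) = +≤+ ℕ.z≤n
lucas-nonneg (suc (suc n)) = +-mono-≤ (lucas-nonneg (suc n)) (lucas-nonneg n)

isSumGCD-scaled : ∀ {G k d} (H : ℕ → ℤ) → 0ℤ ℤ.≤ d → gcd (H 0) (H 1) ≡ 1ℤ →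
                  (∀ n → windowSum G (suc n) k ≡ d * H n) → IsSumGCD G k d
isSumGCD-scaled {d = d} H 0≤d coprime sum≡d*H =
    (λ n → subst (d ∣_) (sym (sum≡d*H n)) (m∣m*n d (H n)))
  , λ c c∣sums → subst (c ∣_) (gcd-*ˡ-coprime {d} {H 0} {H 1} 0≤d coprime)
                       (gcd-greatest {d * H 0} {d * H 1} {c} (subst (c ∣_) (sum≡d*H 0) (c∣sums 0))
                                     (subst (c ∣_) (sum≡d*H 1) (c∣sums 1)))

FibRecurrence : (ℕ → ℤ) → Set
FibRecurrence G = ∀ n → G (suc (suc n)) ≡ G (suc n) ℤ.+ G n

lucas-identity : ∀ G → FibRecurrence G → ∀ m →
                 G (m + m) ℤ.+ -1ℤ ^ m * G 0 ≡ lucas m * G m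
lucas-identity G rec zero = double (G 0)
  where
  double : ∀ x → x ℤ.+ 1ℤ * x ≡ + 2 * x
  double = solve-∀
lucas-identity G rec (suc zero) = trans (cong (ℤ._+ -1ℤ * G 0) (rec 0)) (cancel (G 1) (G 0))
  where
  cancel : ∀ a b → (a ℤ.+ b) ℤ.+ -1ℤ * b ≡ + 1 * a
  cancel = solve-∀
-- The identity for m + 2 is the sum of those for m + 1 (for G shifted by one)
-- and for m (for G shifted by two).
lucas-identity G rec (suc (suc m)) = begin
    G (suc (suc m) + suc (suc m)) ℤ.+ -1ℤ ^ suc (suc m) * G 0
  ≡⟨ cong (ℤ._+ -1ℤ ^ suc (suc m) * G 0) split ⟩
    (G (suc (suc m + suc m)) ℤ.+ G (suc (suc (m + m)))) ℤ.+ -1ℤ ^ suc (suc m) * G 0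
  ≡⟨ regroup (G (suc (suc m + suc m))) (G (suc (suc (m + m)))) (G 1) (G 0) (-1ℤ ^ m) ⟩
    (G (suc (suc m + suc m)) ℤ.+ -1ℤ ^ suc m * G 1) ℤ.+ (G (suc (suc (m + m))) ℤ.+ -1ℤ ^ m * (G 1 ℤ.+ G 0))
  ≡⟨ cong₂ ℤ._+_ (lucas-identity (G ∘ suc) (rec ∘ suc) (suc m))
                 (trans (cong (λ x → G (suc (suc (m + m))) ℤ.+ -1ℤ ^ m * x) (sym (rec 0)))
                        (lucas-identity (G ∘ suc ∘ suc) (rec ∘ suc ∘ suc) m)) ⟩
    lucas (suc m) * G (suc (suc m)) ℤ.+ lucas m * G (suc (suc m))
  ≡⟨ sym (*-distribʳ-+ (G (suc (suc m))) (lucas (suc m)) (lucas m)) ⟩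
    lucas (suc (suc m)) * G (suc (suc m)) ∎
  where
  open ≡-Reasoning
  split : G (suc (suc m) + suc (suc m)) ≡ G (suc (suc m + suc m)) ℤ.+ G (suc (suc (m + m)))
  split = trans (rec (m + suc (suc m)))
                (cong₂ (λ i j → G i ℤ.+ G j) (cong suc (+-suc m (suc m)))
                                           (trans (+-suc m (suc m)) (cong suc (+-suc m m))))
  regroup : ∀ x y a b s → (x ℤ.+ y) ℤ.+ -1ℤ * (-1ℤ * s) * b
                        ≡ (x ℤ.+ -1ℤ * s * a) ℤ.+ (y ℤ.+ s * (a ℤ.+ b))
  regroup = solve-∀

module FibonacciLike (G : ℕ → ℤ) (rec : FibRecurrence G) where

  lucas-identity-odd : ∀ {m} → Odd m → ∀ j →
                       G (m + m + j) - G j ≡ lucas m * G (m + j)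
  lucas-identity-odd {m} odd j = begin
      G (m + m + j) - G j
    ≡⟨ minus-as-sign (G (m + m + j)) (G j) ⟩
      G (m + m + j) ℤ.+ -1ℤ * G j
    ≡⟨ cong (λ s → G (m + m + j) ℤ.+ s * G j) (sym (-1^odd odd)) ⟩
      G (m + m + j) ℤ.+ -1ℤ ^ m * G j
    ≡⟨ lucas-identity (λ i → G (i + j)) (λ n → rec (n + j)) m ⟩
      lucas m * G (m + j) ∎
    where
    open ≡-Reasoning
    minus-as-sign : ∀ x y → x - y ≡ x ℤ.+ -1ℤ * y
    minus-as-sign = solve-∀

  windowSum-telescope : ∀ n k →
                        windowSum G n k ℤ.+ G (suc n) ≡ G (k + suc n)
  windowSum-telescope n zero = +-identityˡ (G (suc n))
  windowSum-telescope n (suc k) = begin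
      (G n ℤ.+ windowSum G (suc n) k) ℤ.+ G (suc n)
    ≡⟨ regroup (G n) (windowSum G (suc n) k) (G (suc n)) ⟩
      windowSum G (suc n) k ℤ.+ (G (suc n) ℤ.+ G n)
    ≡⟨ cong (λ x → windowSum G (suc n) k ℤ.+ x) (sym (rec n)) ⟩
      windowSum G (suc n) k ℤ.+ G (suc (suc n))
    ≡⟨ windowSum-telescope (suc n) k ⟩
      G (k + suc (suc n))
    ≡⟨ cong G (+-suc k (suc n)) ⟩
      G (suc k + suc n) ∎
    where
    open ≡-Reasoning
    regroup : ∀ a w b → (a ℤ.+ w) ℤ.+ b ≡ w ℤ.+ (b ℤ.+ a)
    regroup = solve-∀

  windowSum-odd-twice : ∀ {m} → Odd m → ∀ n →
                        windowSum G (suc n) (m + m) ≡ lucas m * G (m + suc (suc n))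
  windowSum-odd-twice {m} odd n = begin
      windowSum G (suc n) (m + m)
    ≡⟨ add-sub (windowSum G (suc n) (m + m)) (G (suc (suc n))) ⟩
      (windowSum G (suc n) (m + m) ℤ.+ G (suc (suc n))) - G (suc (suc n))
    ≡⟨ cong (_- G (suc (suc n))) (windowSum-telescope (suc n) (m + m)) ⟩
      G (m + m + suc (suc n)) - G (suc (suc n))
    ≡⟨ lucas-identity-odd odd (suc (suc n)) ⟩
      lucas m * G (m + suc (suc n)) ∎
    where
    open ≡-Reasoning
    add-sub : ∀ x y → x ≡ (x ℤ.+ y) - y
    add-sub = solve-∀

  module _ (coprime : gcd (G 0) (G 1) ≡ 1ℤ) where

    consecutive-coprime : ∀ j → gcd (G j) (G (suc j)) ≡ 1ℤ
    consecutive-coprime zero = coprime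
    consecutive-coprime (suc j) =
      ∣1⇒gcd≡1 (G (suc j)) (G (suc (suc j)))
        (subst (g ∣_) (consecutive-coprime j) (gcd-greatest {G j} {G (suc j)} {g} g∣G[j] g∣G[1+j]))
      where
      g = gcd (G (suc j)) (G (suc (suc j)))
      g∣G[1+j] : g ∣ G (suc j)
      g∣G[1+j] = gcd[i,j]∣i (G (suc j)) (G (suc (suc j)))
      g∣G[j] : g ∣ G j
      g∣G[j] = ∣m+n∣m⇒∣n {g} {G (suc j)}
                 (subst (g ∣_) (rec j) (gcd[i,j]∣j (G (suc j)) (G (suc (suc j))))) g∣G[1+j]

    shifted-coprime : ∀ m j → gcd (G (m + j)) (G (m + suc j)) ≡ 1ℤ
    shifted-coprime m j =
      subst (λ i → gcd (G (m + j)) (G i) ≡ 1ℤ) (sym (+-suc m j)) (consecutive-coprime (m + j))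

    lucas-isSumGCD : ∀ {m} → Odd m → IsSumGCD G (m + m) (lucas m)
    lucas-isSumGCD {m} odd =
      isSumGCD-scaled {G} {m + m} (λ n → G (m + suc (suc n))) (lucas-nonneg m) (shifted-coprime m 2)
                      (windowSum-odd-twice odd)

    lucas-gcd-differences : ∀ {m} → Odd m →
                            gcd (G (m + m + 1) - G 1) (G (m + m + 2) - G 2) ≡ lucas m
    lucas-gcd-differences {m} odd =
      trans (cong₂ gcd (lucas-identity-odd odd 1) (lucas-identity-odd odd 2))
            (gcd-*ˡ-coprime {lucas m} {G (m + 1)} {G (m + 2)} (lucas-nonneg m) (shifted-coprime m 1))

theorem4p8 : (G : ℕ → ℤ) → gcd (G 0) (G 1) ≡ + 1 →
    (∀ n → G (suc (suc n)) ≡ G (suc n) Data.Integer.+ G n) →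
    (k : ℕ) → 0 < k → (k % 12 ≡ 2 ⊎ k % 12 ≡ 6 ⊎ k % 12 ≡ 10) →
    (gcd (G (k + 1) - G 1) (G (k + 2) - G 2) ≡ lucas (k / 2))
    × IsSumGCD fib k (lucas (k / 2))
    × IsSumGCD lucas k (lucas (k / 2))
    × IsSumGCD G k (lucas (k / 2))
-- Positivity of k is implied by the residue condition.
theorem4p8 G coprime rec k _ k%12 with k%4≡2⇒twice-odd k (k%12≡2,6,10⇒k%4≡2 k k%12)
... | m , odd , refl rewrite [m+m]/2≡m m =
    FibonacciLike.lucas-gcd-differences G rec coprime odd
  , FibonacciLike.lucas-isSumGCD fib (λ _ → refl) refl odd
  , FibonacciLike.lucas-isSumGCD lucas (λ _ → refl) refl odd
  , FibonacciLike.lucas-isSumGCD G rec coprime odd
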